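{- Let $\mathbb N_B\subseteq\mathbb N$ be an arbitrary fixed set, let $(q_n)_{n\ge1}$ be a fixed sequence of integers with $q_n>1$ for all $n$, and set $a_n=-1$ if $n\in\mathbb N_B$ and $a_n=1$ if $n\notin\mathbb N_B$. Let $x=\sum_{k=1}^{\infty}\frac{a_k\varepsilon_k}{q_1q_2\cdots q_k}$ with $\varepsilon_k\in\{0,1,\dots,q_k-1\}$ for all $k$, and for $n\in\mathbb Z_0=\mathbb N\cup\{0\}$ define $$\sigma^n(x)=\sum_{k=n+1}^{\infty}\frac{a_k\varepsilon_k}{q_{n+1}q_{n+2}\cdots q_k}$$ (computed from the given digit sequence $(\varepsilon_k)$; $\sigma^0(x)=x$). Then $x$ is rational if and only if there exist $n\in\mathbb Z_0$ and $m\in\mathbb N$ such that $\sigma^n(x)=\sigma^{n+m}(x)$.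
   Context: $\sigma$ is the shift operator of the sign-variable Cantor expansion: it deletes the first digit and rescales, so that $x=\sum_{i=1}^n\frac{a_i\varepsilon_i}{q_1\cdots q_i}+\frac{\sigma^n(x)}{q_1\cdots q_n}$. -}

module Defs where

open import Data.Bool using (Bool; true; false; if_then_else_)
open import Data.Nat as ℕ using (ℕ; zero; suc; _+_; _≤_; _<_; s≤s; z≤n)
import Data.Nat.Properties as ℕP
open import Data.Integer as ℤ using (ℤ; +_)
open import Data.Rational using (ℚ; 0ℚ; 1ℚ; _/_; -_; _-_; ∣_∣) renaming (_+_ to _+ℚ_; _*_ to _*ℚ_; _≤_ to _≤ℚ_; _<_ to _<ℚ_)
open import Data.Product using (∃; Σ; _×_; _,_)

-- Indexing follows the paper: q, ε and N_B are indexed by k ≥ 1;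
-- the values at index 0 are never used.
-- N_B ⊆ ℕ is given by its characteristic function inB : ℕ → Bool.

aSign : (inB : ℕ → Bool) → ℕ → ℚ
aSign inB k = if inB k then - 1ℚ else 1ℚ

recipQ : (q : ℕ → ℕ) → (∀ k → 1 ≤ k → 2 ≤ q k) → ℕ → ℚ
recipQ q hq k = _/_ (+ 1) (q (suc k)) {{ℕ.>-nonZero (ℕP.≤-trans (s≤s z≤n) (hq (suc k) (s≤s z≤n)))}}
-- NB: recipQ q hq j = 1 / q_{j+1}

-- prodRecip n l = 1 / (q_{n+1} q_{n+2} ⋯ q_{n+l})
prodRecip : (q : ℕ → ℕ) → (∀ k → 1 ≤ k → 2 ≤ q k) → ℕ → ℕ → ℚ
prodRecip q hq n zero = 1ℚ
prodRecip q hq n (suc l) = prodRecip q hq n l *ℚ recipQ q hq (n + l)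

-- sigmaPartial n N = Σ_{k=n+1}^{n+N} a_k ε_k / (q_{n+1} ⋯ q_k),
-- the N-th partial sum of the series defining σ^n(x).
sigmaPartial : (inB : ℕ → Bool) (q : ℕ → ℕ) → (∀ k → 1 ≤ k → 2 ≤ q k) →
               (ε : ℕ → ℕ) → ℕ → ℕ → ℚ
sigmaPartial inB q hq ε n zero = 0ℚ
sigmaPartial inB q hq ε n (suc N) =
  sigmaPartial inB q hq ε n N
    +ℚ (aSign inB (suc (n + N)) *ℚ ((+ ε (suc (n + N))) / 1)) *ℚ prodRecip q hq n (suc N)

ConvergesTo : (ℕ → ℚ) → ℚ → Set
ConvergesTo s r = ∀ (δ : ℚ) → 0ℚ <ℚ δ → ∃ λ N → ∀ M → N ≤ M → ∣ s M - r ∣ ≤ℚ δ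

-- x = σ^0(x) is a rational number: the series converges to some r ∈ ℚ.
IsRationalSum : (inB : ℕ → Bool) (q : ℕ → ℕ) → (∀ k → 1 ≤ k → 2 ≤ q k) → (ε : ℕ → ℕ) → Set
IsRationalSum inB q hq ε = ∃ λ (r : ℚ) → ConvergesTo (sigmaPartial inB q hq ε 0) r

-- σ^n(x) = σ^{n'}(x) as real numbers: both series converge (absolutely),
-- so equality of their sums means the difference of partial sums tends to 0.
SigmaEq : (inB : ℕ → Bool) (q : ℕ → ℕ) → (∀ k → 1 ≤ k → 2 ≤ q k) → (ε : ℕ → ℕ) → ℕ → ℕ → Set
SigmaEq inB q hq ε n n' =
  ConvergesTo (λ N → sigmaPartial inB q hq ε n N - sigmaPartial inB q hq ε n' N) 0ℚ

-- Write S n N for the partial sums of σⁿ(x) and P n N = 1/(q_{n+1}⋯q_{n+N}).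
-- Splitting a partial sum gives S n (m + N) = S n m + P n m · S (n+m) N, and the digit bound
-- ε_k < q_k gives ∣S n N∣ ≤ 1.
-- If σⁿ(x) = σⁿ⁺ᵐ(x), the splitting identity in the limit reads σⁿ = S n m + P n m · σⁿ, so
-- σⁿ(x) = S n m / (1 − P n m) is rational, and then so is x = S 0 n + P 0 n · σⁿ(x).
-- Conversely, if x = a/d then σᵏ(x) = (x − S 0 k) · q₁⋯q_k, and d · σᵏ(x) is an integer of
-- absolute value at most d; by the pigeonhole principle two of these integers coincide.
module Submission where

open import Defs
open import Data.Bool using (Bool)
open import Data.Nat as ℕ using (ℕ)

module Arithmetic where

  open import Data.Integer as ℤ using (ℤ; +_; -[1+_])
  import Data.Integer.Properties as ℤₚ
  open import Data.Nat using (zero; suc; s≤s; z≤n)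
    renaming (_≤_ to _≤ₙ_; _<_ to _<ₙ_; _+_ to _+ₙ_)
  import Data.Nat.Properties as ℕₚ
  open import Data.Nat.Coprimality using (1-coprimeTo) renaming (sym to coprime-sym)
  open import Data.Rational as ℚ
    using (ℚ; mkℚ; 0ℚ; 1ℚ; _/_; -_; _+_; _-_; _*_; _≤_; _<_; ∣_∣; ↥_; ↧ₙ_)
  import Data.Rational.Properties as ℚₚ
  import Data.Rational.Unnormalised as ℚᵘ
  import Data.Rational.Unnormalised.Properties as ℚᵘₚ
  open import Data.Fin using (Fin; toℕ; fromℕ<)
  import Data.Fin.Properties as Finₚ
  open import Data.Product using (Σ; ∃₂; _×_; _,_)
  open import Relation.Binary.PropositionalEquality
  open import Relation.Nullary using (contradiction)
  open import Relation.Nullary.Decidable using (dec⇒maybe)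
  open import Level using (0ℓ)
  open import Tactic.RingSolver using (solve-∀)
  open import Tactic.RingSolver.Core.AlmostCommutativeRing
    using (AlmostCommutativeRing; fromCommutativeRing)

  ℚ-ring : AlmostCommutativeRing 0ℓ 0ℓ
  ℚ-ring = fromCommutativeRing ℚₚ.+-*-commutativeRing (λ x → dec⇒maybe (0ℚ ℚₚ.≟ x))

  *-monoˡ-≤-0≤ : ∀ {r p q} → 0ℚ ≤ r → p ≤ q → r * p ≤ r * q
  *-monoˡ-≤-0≤ {r} 0≤r = ℚₚ.*-monoˡ-≤-nonNeg r {{ℚ.nonNegative 0≤r}}

  *-monoʳ-≤-0≤ : ∀ {r p q} → 0ℚ ≤ r → p ≤ q → p * r ≤ q * r
  *-monoʳ-≤-0≤ {r} 0≤r = ℚₚ.*-monoʳ-≤-nonNeg r {{ℚ.nonNegative 0≤r}}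

  0<* : ∀ {p q} → 0ℚ < p → 0ℚ < q → 0ℚ < p * q
  0<* {p} {q} 0<p 0<q =
    ℚₚ.positive⁻¹ _ {{ℚₚ.pos*pos⇒pos p {{ℚ.positive 0<p}} q {{ℚ.positive 0<q}}}}

  ∣r*p∣≡r*∣p∣ : ∀ {r} p → 0ℚ ≤ r → ∣ r * p ∣ ≡ r * ∣ p ∣
  ∣r*p∣≡r*∣p∣ {r} p 0≤r = trans (ℚₚ.∣p*q∣≡∣p∣*∣q∣ r p) (cong (_* ∣ p ∣) (ℚₚ.0≤p⇒∣p∣≡p 0≤r))

  p<q⇒0<q-p : ∀ {p q} → p < q → 0ℚ < q - p
  p<q⇒0<q-p {p} {q} p<q = ℚₚ.≤-<-trans (ℚₚ.≤-reflexive (sym (ℚₚ.+-inverseʳ p))) (ℚₚ.+-monoˡ-< (- p) p<q)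

  *-cancelʳ-≡-pos : ∀ {p q r} → 0ℚ < r → p * r ≡ q * r → p ≡ q
  *-cancelʳ-≡-pos {r = r} 0<r pr≡qr = ℚₚ.≤-antisym
    (ℚₚ.*-cancelʳ-≤-pos r {{ℚ.positive 0<r}} (ℚₚ.≤-reflexive pr≡qr))
    (ℚₚ.*-cancelʳ-≤-pos r {{ℚ.positive 0<r}} (ℚₚ.≤-reflexive (sym pr≡qr)))

  ∣p-q∣≡∣q-p∣ : ∀ p q → ∣ p - q ∣ ≡ ∣ q - p ∣
  ∣p-q∣≡∣q-p∣ p q = trans (sym (ℚₚ.∣-p∣≡∣p∣ (p - q))) (cong ∣_∣ (negate p q))
    where
    negate : ∀ p q → - (p - q) ≡ q - p
    negate = solve-∀ ℚ-ring

  fromℤ : ℤ → ℚ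
  fromℤ z = z / 1

  fromℕ : ℕ → ℚ
  fromℕ n = fromℤ (+ n)

  fromℤ≡mkℚ : ∀ z → fromℤ z ≡ mkℚ z 0 (coprime-sym (1-coprimeTo ℤ.∣ z ∣))
  fromℤ≡mkℚ (+ n) = ℚₚ.normalize-coprime (coprime-sym (1-coprimeTo n))
  fromℤ≡mkℚ -[1+ n ] = cong -_ (ℚₚ.normalize-coprime (coprime-sym (1-coprimeTo (suc n))))

  fromℤ-homo-+ : ∀ a b → fromℤ (a ℤ.+ b) ≡ fromℤ a + fromℤ b
  fromℤ-homo-+ a b rewrite fromℤ≡mkℚ a | fromℤ≡mkℚ b =
    cong fromℤ (cong₂ ℤ._+_ (sym (ℤₚ.*-identityʳ a)) (sym (ℤₚ.*-identityʳ b)))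

  fromℤ-homo-* : ∀ a b → fromℤ (a ℤ.* b) ≡ fromℤ a * fromℤ b
  fromℤ-homo-* a b rewrite fromℤ≡mkℚ a | fromℤ≡mkℚ b = refl

  fromℤ-homo-neg : ∀ a → fromℤ (ℤ.- a) ≡ - fromℤ a
  fromℤ-homo-neg a rewrite fromℤ≡mkℚ a | fromℤ≡mkℚ (ℤ.- a) with a
  ... | + zero = refl
  ... | + suc n = refl
  ... | -[1+ n ] = refl

  fromℕ-homo-* : ∀ m n → fromℕ (m ℕ.* n) ≡ fromℕ m * fromℕ n
  fromℕ-homo-* m n = trans (cong fromℤ (ℤₚ.pos-* m n)) (fromℤ-homo-* (+ m) (+ n))

  fromℤ-mono-≤ : ∀ {a b} → a ℤ.≤ b → fromℤ a ≤ fromℤ b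
  fromℤ-mono-≤ {a} {b} a≤b rewrite fromℤ≡mkℚ a | fromℤ≡mkℚ b =
    ℚ.*≤* (subst₂ ℤ._≤_ (sym (ℤₚ.*-identityʳ a)) (sym (ℤₚ.*-identityʳ b)) a≤b)

  fromℤ-cancel-≤ : ∀ {a b} → fromℤ a ≤ fromℤ b → a ℤ.≤ b
  fromℤ-cancel-≤ {a} {b} le rewrite fromℤ≡mkℚ a | fromℤ≡mkℚ b with le
  ... | ℚ.*≤* ab = subst₂ ℤ._≤_ (ℤₚ.*-identityʳ a) (ℤₚ.*-identityʳ b) ab

  fromℕ-mono-≤ : ∀ {m n} → m ≤ₙ n → fromℕ m ≤ fromℕ n
  fromℕ-mono-≤ m≤n = fromℤ-mono-≤ (ℤ.+≤+ m≤n)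

  0≤fromℕ : ∀ n → 0ℚ ≤ fromℕ n
  0≤fromℕ n = fromℕ-mono-≤ {0} {n} z≤n

  ∣fromℤ∣≡fromℕ∣∣ : ∀ z → ∣ fromℤ z ∣ ≡ fromℕ ℤ.∣ z ∣
  ∣fromℤ∣≡fromℕ∣∣ z rewrite fromℤ≡mkℚ z | fromℤ≡mkℚ (+ ℤ.∣ z ∣) = refl

  1/n*n≡1 : ∀ n .{{_ : ℕ.NonZero n}} → (+ 1 / n) * fromℕ n ≡ 1ℚ
  1/n*n≡1 (suc n) rewrite ℚₚ.normalize-coprime {1} {n} (1-coprimeTo (suc n)) | fromℤ≡mkℚ (+ suc n) =
    ℚₚ.*-inverseˡ (mkℚ (+ suc n) 0 (coprime-sym (1-coprimeTo (suc n))))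

  0<1/n : ∀ n .{{_ : ℕ.NonZero n}} → 0ℚ < + 1 / n
  0<1/n (suc n) = ℚₚ.positive⁻¹ _ {{ℚₚ.normalize-pos 1 (suc n)}}

  0<fromℕ-↧ : ∀ p → 0ℚ < fromℕ (↧ₙ p)
  0<fromℕ-↧ p = ℚₚ.positive⁻¹ (fromℕ (↧ₙ p)) {{ℚₚ.normalize-pos (↧ₙ p) 1}}

  p*↧p≡↥p : ∀ p → p * fromℕ (↧ₙ p) ≡ fromℤ (↥ p)
  p*↧p≡↥p (mkℚ n d c) = ℚₚ.toℚᵘ-injective
    (ℚᵘₚ.≃-trans (ℚₚ.toℚᵘ-homo-* (mkℚ n d c) (fromℕ (suc d)))
                 (cross-multiply (fromℕ (suc d)) (fromℤ≡mkℚ (+ suc d)) (fromℤ n) (fromℤ≡mkℚ n)))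
    where
    cross-multiply : ∀ x → x ≡ mkℚ (+ suc d) 0 (coprime-sym (1-coprimeTo (suc d))) →
                     ∀ y → y ≡ mkℚ n 0 (coprime-sym (1-coprimeTo ℤ.∣ n ∣)) →
                     (ℚᵘ.mkℚᵘ n d ℚᵘ.* ℚ.toℚᵘ x) ℚᵘ.≃ ℚ.toℚᵘ y
    cross-multiply x refl y refl =
      ℚᵘ.*≡* (trans (ℤₚ.*-identityʳ _) (cong (λ k → n ℤ.* + suc k) (sym (ℕₚ.*-identityʳ d))))

  archimedean : ∀ δ → 0ℚ < δ → Σ ℕ λ K → 1ℚ ≤ δ * fromℕ K
  archimedean (mkℚ (+ zero) _ _) (ℚ.*<* (ℤ.+<+ ()))
  archimedean (mkℚ -[1+ _ ] _ _) (ℚ.*<* ())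
  archimedean δ@(mkℚ (+ suc a) b _) _ =
    suc b , ℚₚ.≤-trans (fromℤ-mono-≤ {+ 1} {+ suc a} (ℤ.+≤+ (s≤s z≤n))) (ℚₚ.≤-reflexive (sym (p*↧p≡↥p δ)))

  module _ (d : ℕ) where

    boundedIndex : ℤ → ℕ
    boundedIndex (+ k) = k
    boundedIndex -[1+ k ] = d +ₙ suc k

    boundedIndex< : ∀ z → ℤ.∣ z ∣ ≤ₙ d → boundedIndex z <ₙ suc (d +ₙ d)
    boundedIndex< (+ k) k≤d = s≤s (ℕₚ.≤-trans k≤d (ℕₚ.m≤m+n d d))
    boundedIndex< -[1+ k ] k<d = s≤s (ℕₚ.+-monoʳ-≤ d k<d)

    boundedIndex-injective : ∀ y z → ℤ.∣ y ∣ ≤ₙ d → ℤ.∣ z ∣ ≤ₙ d →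
                             boundedIndex y ≡ boundedIndex z → y ≡ z
    boundedIndex-injective (+ k) (+ l) _ _ k≡l = cong +_ k≡l
    boundedIndex-injective (+ k) -[1+ l ] k≤d _ k≡ =
      contradiction (subst (_≤ₙ d) k≡ k≤d) (ℕₚ.<⇒≱ (ℕₚ.m<m+n d ℕₚ.0<1+n))
    boundedIndex-injective -[1+ k ] (+ l) _ l≤d ≡l =
      contradiction (subst (_≤ₙ d) (sym ≡l) l≤d) (ℕₚ.<⇒≱ (ℕₚ.m<m+n d ℕₚ.0<1+n))
    boundedIndex-injective -[1+ k ] -[1+ l ] _ _ eq =
      cong -[1+_] (ℕₚ.suc-injective (ℕₚ.+-cancelˡ-≡ d (suc k) (suc l) eq))

  bounded-pigeonhole : ∀ d (z : ℕ → ℤ) → (∀ k → ℤ.∣ z k ∣ ≤ₙ d) →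
                       ∃₂ λ i j → i <ₙ j × z i ≡ z j
  bounded-pigeonhole d z bounded =
    let i , j , i<j , index≡ = Finₚ.pigeonhole (ℕₚ.n<1+n (suc (d +ₙ d))) index
    in toℕ i , toℕ j , i<j ,
       boundedIndex-injective d _ _ (bounded (toℕ i)) (bounded (toℕ j))
         (trans (sym (Finₚ.toℕ-fromℕ< _)) (trans (cong toℕ index≡) (Finₚ.toℕ-fromℕ< _)))
    where
    index : Fin (suc (suc (d +ₙ d))) → Fin (suc (d +ₙ d))
    index i = fromℕ< (boundedIndex< d (z (toℕ i)) (bounded (toℕ i)))

module Convergence where

  open Arithmetic
  open import Data.Nat using (_∸_) renaming (_≤_ to _≤ₙ_; _+_ to _+ₙ_)
  import Data.Nat.Properties as ℕₚ
  open import Data.Rational as ℚ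
    using (ℚ; 0ℚ; 1ℚ; ½; -_; _+_; _-_; _*_; 1/_; _≤_; _<_; ∣_∣)
  import Data.Rational.Properties as ℚₚ
  open import Data.Empty using (⊥-elim)
  open import Data.Product using (_,_)
  open import Relation.Binary.PropositionalEquality
  open import Relation.Nullary using (yes; no)
  open import Tactic.RingSolver using (solve-∀)
  open ℚₚ.≤-Reasoning

  -- ConvergesTo unfolds to a Π-type, which hides the sequence and the limit from unification;
  -- this wrapper keeps both inferable in the limit laws below.
  record _⟶_ (f : ℕ → ℚ) (r : ℚ) : Set where
    constructor limit
    field converges : ConvergesTo f r

  open _⟶_ public

  private
    variable
      f g : ℕ → ℚ
      a b r : ℚ

  0<½* : ∀ {δ} → 0ℚ < δ → 0ℚ < ½ * δ
  0<½* = 0<* (ℚₚ.positive⁻¹ ½)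

  ≤-by-margins : (∀ δ → 0ℚ < δ → a ≤ b + δ) → a ≤ b
  ≤-by-margins {a} {b} a≤b+δ with a ℚₚ.≤? b
  ... | yes a≤b = a≤b
  ... | no a≰b with ℚₚ.<-dense (ℚₚ.≰⇒> a≰b)
  ...   | c , b<c , c<a = ⊥-elim (ℚₚ.<-irrefl refl (ℚₚ.<-≤-trans c<a (begin
    a               ≤⟨ a≤b+δ (c - b) (p<q⇒0<q-p b<c) ⟩
    b + (c - b)     ≡⟨ b+[c-b]≡c b c ⟩
    c               ∎)))
    where
    b+[c-b]≡c : ∀ b c → b + (c - b) ≡ c
    b+[c-b]≡c = solve-∀ ℚ-ring

  ⟶-cong : (∀ N → f N ≡ g N) → f ⟶ r → g ⟶ r
  ⟶-cong {r = r} f≡g (limit f→r) = limit λ δ 0<δ →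
    let K , close = f→r δ 0<δ in
    K , λ M K≤M → subst (λ x → ∣ x - r ∣ ≤ δ) (f≡g M) (close M K≤M)

  ⟶-const : ∀ r → (λ _ → r) ⟶ r
  ⟶-const r = limit λ δ 0<δ →
    0 , λ _ _ → subst (_≤ δ) (cong ∣_∣ (sym (ℚₚ.+-inverseʳ r))) (ℚₚ.<⇒≤ 0<δ)

  ⟶-+ : f ⟶ a → g ⟶ b → (λ N → f N + g N) ⟶ (a + b)
  ⟶-+ {f} {a} {g} {b} (limit f→a) (limit g→b) = limit λ δ 0<δ →
    let K , f-close = f→a (½ * δ) (0<½* 0<δ)
        L , g-close = g→b (½ * δ) (0<½* 0<δ)
    in K +ₙ L , λ M K+L≤M → begin
      ∣ f M + g M - (a + b) ∣       ≡⟨ cong ∣_∣ (regroup (f M) (g M) a b) ⟩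
      ∣ (f M - a) + (g M - b) ∣     ≤⟨ ℚₚ.∣p+q∣≤∣p∣+∣q∣ (f M - a) (g M - b) ⟩
      ∣ f M - a ∣ + ∣ g M - b ∣     ≤⟨ ℚₚ.+-mono-≤
                                        (f-close M (ℕₚ.≤-trans (ℕₚ.m≤m+n K L) K+L≤M))
                                        (g-close M (ℕₚ.≤-trans (ℕₚ.m≤n+m L K) K+L≤M)) ⟩
      ½ * δ + ½ * δ                 ≡⟨ halves δ ⟩
      δ                             ∎
    where
    regroup : ∀ x y a b → x + y - (a + b) ≡ (x - a) + (y - b)
    regroup = solve-∀ ℚ-ring
    halves : ∀ δ → ½ * δ + ½ * δ ≡ δ
    halves = solve-∀ ℚ-ring

  -- The tolerance δ / (1 + ∣p∣) avoids dividing by p, which may vanish.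
  ⟶-*ˡ : ∀ p → f ⟶ r → (λ N → p * f N) ⟶ (p * r)
  ⟶-*ˡ {f} {r} p (limit f→r) = limit λ δ 0<δ →
    let c = 1ℚ + ∣ p ∣
        instance
          c-positive : ℚ.Positive c
          c-positive = ℚₚ.pos+nonNeg⇒pos 1ℚ ∣ p ∣ {{ℚₚ.∣-∣-nonNeg p}}
          c-nonZero : ℚ.NonZero c
          c-nonZero = ℚₚ.pos⇒nonZero c
        0<δ/c = 0<* 0<δ (ℚₚ.positive⁻¹ (1/ c) {{ℚₚ.1/pos⇒pos c}})
        K , close = f→r (δ * 1/ c) 0<δ/c
    in K , λ M K≤M → begin
      ∣ p * f M - p * r ∣   ≡⟨ trans (cong ∣_∣ (factor p (f M) r)) (ℚₚ.∣p*q∣≡∣p∣*∣q∣ p (f M - r)) ⟩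
      ∣ p ∣ * ∣ f M - r ∣   ≤⟨ *-monoˡ-≤-0≤ (ℚₚ.0≤∣p∣ p) (close M K≤M) ⟩
      ∣ p ∣ * (δ * 1/ c)   ≤⟨ *-monoʳ-≤-0≤ (ℚₚ.<⇒≤ 0<δ/c) (∣p∣≤1+∣p∣ p) ⟩
      c * (δ * 1/ c)       ≡⟨ swap c δ (1/ c) ⟩
      δ * (c * 1/ c)       ≡⟨ trans (cong (δ *_) (ℚₚ.*-inverseʳ c)) (ℚₚ.*-identityʳ δ) ⟩
      δ                    ∎
    where
    ∣p∣≤1+∣p∣ : ∀ p → ∣ p ∣ ≤ 1ℚ + ∣ p ∣
    ∣p∣≤1+∣p∣ p = ℚₚ.≤-trans (ℚₚ.≤-reflexive (sym (ℚₚ.+-identityˡ ∣ p ∣)))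
                             (ℚₚ.+-monoˡ-≤ ∣ p ∣ (ℚₚ.nonNegative⁻¹ 1ℚ))
    factor : ∀ p x r → p * x - p * r ≡ p * (x - r)
    factor = solve-∀ ℚ-ring
    swap : ∀ c δ d → c * (δ * d) ≡ δ * (c * d)
    swap = solve-∀ ℚ-ring

  ⟶-− : f ⟶ a → g ⟶ b → (λ N → f N - g N) ⟶ (a - b)
  ⟶-− {f} {a} {g} {b} f→a g→b =
    subst ((λ N → f N - g N) ⟶_) (plus-minus a b)
      (⟶-cong (λ N → plus-minus (f N) (g N)) (⟶-+ f→a (⟶-*ˡ (- 1ℚ) g→b)))
    where
    plus-minus : ∀ x y → x + - 1ℚ * y ≡ x - y
    plus-minus = solve-∀ ℚ-ring

  ⟶-shift : ∀ k → f ⟶ r → (λ N → f (k +ₙ N)) ⟶ r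
  ⟶-shift k (limit f→r) = limit λ δ 0<δ →
    let K , close = f→r δ 0<δ in
    K , λ M K≤M → close (k +ₙ M) (ℕₚ.≤-trans K≤M (ℕₚ.m≤n+m M k))

  ⟶-unshift : ∀ k → (λ N → f (k +ₙ N)) ⟶ r → f ⟶ r
  ⟶-unshift {f} {r} k (limit f[k+]→r) = limit λ δ 0<δ →
    let K , close = f[k+]→r δ 0<δ in
    k +ₙ K , λ M k+K≤M →
      let k+[M∸k]≡M = ℕₚ.m+[n∸m]≡n (ℕₚ.≤-trans (ℕₚ.m≤m+n k K) k+K≤M)
      in subst (λ i → ∣ f i - r ∣ ≤ δ) k+[M∸k]≡M
           (close (M ∸ k) (ℕₚ.+-cancelˡ-≤ k K (M ∸ k) (subst (k +ₙ K ≤ₙ_) (sym k+[M∸k]≡M) k+K≤M)))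

  ⟶-squeeze : (∀ N → ∣ f N ∣ ≤ g N) → g ⟶ 0ℚ → f ⟶ 0ℚ
  ⟶-squeeze {f} {g} ∣f∣≤g (limit g→0) = limit λ δ 0<δ →
    let K , close = g→0 δ 0<δ in
    K , λ M K≤M → begin
      ∣ f M - 0ℚ ∣   ≡⟨ cong ∣_∣ (ℚₚ.+-identityʳ (f M)) ⟩
      ∣ f M ∣        ≤⟨ ∣f∣≤g M ⟩
      g M            ≡⟨ sym (trans (cong ∣_∣ (ℚₚ.+-identityʳ (g M))) (ℚₚ.0≤p⇒∣p∣≡p (0≤g M))) ⟩
      ∣ g M - 0ℚ ∣   ≤⟨ close M K≤M ⟩
      δ              ∎
    where
    0≤g : ∀ N → 0ℚ ≤ g N
    0≤g N = ℚₚ.≤-trans (ℚₚ.0≤∣p∣ (f N)) (∣f∣≤g N)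

  ⟶-bounded : (∀ N → ∣ f N ∣ ≤ b) → f ⟶ r → ∣ r ∣ ≤ b
  ⟶-bounded {f} {b} {r} ∣f∣≤b (limit f→r) = ≤-by-margins λ δ 0<δ →
    let K , close = f→r δ 0<δ in begin
      ∣ r ∣                   ≡⟨ cong ∣_∣ (split (f K) r) ⟩
      ∣ f K + (r - f K) ∣     ≤⟨ ℚₚ.∣p+q∣≤∣p∣+∣q∣ (f K) (r - f K) ⟩
      ∣ f K ∣ + ∣ r - f K ∣   ≤⟨ ℚₚ.+-mono-≤ (∣f∣≤b K)
                                  (ℚₚ.≤-trans (ℚₚ.≤-reflexive (∣p-q∣≡∣q-p∣ r (f K))) (close K ℕₚ.≤-refl)) ⟩
      b + δ                   ∎
    where
    split : ∀ x r → r ≡ x + (r - x)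
    split = solve-∀ ℚ-ring

module SignVariableCantorSeries
  (inB : ℕ → Bool) (q : ℕ → ℕ) (hq : ∀ k → 1 ℕ.≤ k → 2 ℕ.≤ q k) (ε : ℕ → ℕ) where

  open Arithmetic
  open Convergence
  open import Data.Bool using (true; false; if_then_else_)
  open import Data.Integer as ℤ using (ℤ)
  import Data.Integer.Properties as ℤₚ
  open import Data.Nat using (zero; suc; s≤s; z≤n; _∸_)
    renaming (_≤_ to _≤ₙ_; _<_ to _<ₙ_; _+_ to _+ₙ_)
  import Data.Nat.Properties as ℕₚ
  open import Data.Rational as ℚ
    using (ℚ; 0ℚ; 1ℚ; -_; _+_; _-_; _*_; 1/_; _≤_; _<_; ∣_∣; ↥_; ↧ₙ_)
  import Data.Rational.Properties as ℚₚ
  open import Data.Product using (∃₂; _×_; _,_)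
  open import Relation.Binary.PropositionalEquality
  open import Tactic.RingSolver using (solve-∀)

  S : ℕ → ℕ → ℚ
  S = sigmaPartial inB q hq ε

  P : ℕ → ℕ → ℚ
  P = prodRecip q hq

  recip : ℕ → ℚ
  recip = recipQ q hq

  term : ℕ → ℚ
  term k = aSign inB k * fromℕ (ε k)

  instance
    q-nonZero : ∀ {k} → ℕ.NonZero (q (suc k))
    q-nonZero {k} = ℕ.>-nonZero (ℕₚ.≤-trans (s≤s z≤n) (hq (suc k) (s≤s z≤n)))

  recip*q≡1 : ∀ k → recip k * fromℕ (q (suc k)) ≡ 1ℚ
  recip*q≡1 k = 1/n*n≡1 (q (suc k))

  0<recip : ∀ k → 0ℚ < recip k
  0<recip k = 0<1/n (q (suc k))

  0<prodRecip : ∀ n l → 0ℚ < P n l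
  0<prodRecip n zero = ℚₚ.positive⁻¹ 1ℚ
  0<prodRecip n (suc l) = 0<* (0<prodRecip n l) (0<recip (n +ₙ l))

  0≤prodRecip : ∀ n l → 0ℚ ≤ P n l
  0≤prodRecip n l = ℚₚ.<⇒≤ (0<prodRecip n l)

  prodRecip-+ : ∀ n m l → P n (m +ₙ l) ≡ P n m * P (n +ₙ m) l
  prodRecip-+ n m zero = trans (cong (P n) (ℕₚ.+-identityʳ m)) (sym (ℚₚ.*-identityʳ (P n m)))
  prodRecip-+ n m (suc l) = begin
    P n (m +ₙ suc l)
      ≡⟨ cong (P n) (ℕₚ.+-suc m l) ⟩
    P n (m +ₙ l) * recip (n +ₙ (m +ₙ l))
      ≡⟨ cong₂ _*_ (prodRecip-+ n m l) (cong recip (sym (ℕₚ.+-assoc n m l))) ⟩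
    P n m * P (n +ₙ m) l * recip (n +ₙ m +ₙ l)
      ≡⟨ ℚₚ.*-assoc (P n m) _ _ ⟩
    P n m * P (n +ₙ m) (suc l)
      ∎
    where open ≡-Reasoning

  sigmaPartial-+ : ∀ n m N → S n (m +ₙ N) ≡ S n m + P n m * S (n +ₙ m) N
  sigmaPartial-+ n m zero =
    trans (cong (S n) (ℕₚ.+-identityʳ m)) (add-zero (S n m) (P n m))
    where
    add-zero : ∀ a b → a ≡ a + b * 0ℚ
    add-zero = solve-∀ ℚ-ring
  sigmaPartial-+ n m (suc N) = begin
    S n (m +ₙ suc N)
      ≡⟨ cong (S n) (ℕₚ.+-suc m N) ⟩
    S n (m +ₙ N) + term (suc (n +ₙ (m +ₙ N))) * P n (suc (m +ₙ N))
      ≡⟨ cong₂ (λ s k → s + term (suc k) * P n (suc (m +ₙ N)))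
               (sigmaPartial-+ n m N) (sym (ℕₚ.+-assoc n m N)) ⟩
    (S n m + P n m * S (n +ₙ m) N) + t * P n (suc (m +ₙ N))
      ≡⟨ cong (λ p → (S n m + P n m * S (n +ₙ m) N) + t * p)
              (trans (cong (P n) (sym (ℕₚ.+-suc m N))) (prodRecip-+ n m (suc N))) ⟩
    (S n m + P n m * S (n +ₙ m) N) + t * (P n m * P (n +ₙ m) (suc N))
      ≡⟨ factor (S n m) (P n m) (S (n +ₙ m) N) t (P (n +ₙ m) (suc N)) ⟩
    S n m + P n m * S (n +ₙ m) (suc N)
      ∎
    where
    open ≡-Reasoning
    t = term (suc (n +ₙ m +ₙ N))
    factor : ∀ a b c d e → (a + b * c) + d * (b * e) ≡ a + b * (c + d * e)
    factor = solve-∀ ℚ-ring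

  prodRecip-1 : ∀ n → P n 1 ≡ recip n
  prodRecip-1 n = trans (ℚₚ.*-identityˡ (recip (n +ₙ 0))) (cong recip (ℕₚ.+-identityʳ n))

  sigmaPartial-1 : ∀ n → S n 1 ≡ term (suc n) * recip n
  sigmaPartial-1 n = trans (ℚₚ.+-identityˡ _)
    (cong₂ _*_ (cong (λ k → term (suc k)) (ℕₚ.+-identityʳ n)) (prodRecip-1 n))

  recip*[2+l]≤1+l : ∀ k l → recip k * fromℕ (suc (suc l)) ≤ fromℕ (suc l)
  recip*[2+l]≤1+l k l = begin
    recip k * fromℕ (suc (suc l))
      ≤⟨ *-monoˡ-≤-0≤ (ℚₚ.<⇒≤ (0<recip k)) (fromℕ-mono-≤ 2+l≤q*[1+l]) ⟩
    recip k * fromℕ (q (suc k) ℕ.* suc l)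
      ≡⟨ cong (recip k *_) (fromℕ-homo-* (q (suc k)) (suc l)) ⟩
    recip k * (fromℕ (q (suc k)) * fromℕ (suc l))
      ≡⟨ sym (ℚₚ.*-assoc (recip k) _ _) ⟩
    recip k * fromℕ (q (suc k)) * fromℕ (suc l)
      ≡⟨ trans (cong (_* fromℕ (suc l)) (recip*q≡1 k)) (ℚₚ.*-identityˡ _) ⟩
    fromℕ (suc l)
      ∎
    where
    open ℚₚ.≤-Reasoning
    2+l≤q*[1+l] : suc (suc l) ≤ₙ q (suc k) ℕ.* suc l
    2+l≤q*[1+l] = ℕₚ.≤-trans
      (s≤s (subst (suc l ≤ₙ_) (cong (l +ₙ_) (sym (ℕₚ.+-identityʳ (suc l)))) (ℕₚ.m≤n+m (suc l) l)))
      (ℕₚ.*-monoˡ-≤ (suc l) (hq (suc k) (s≤s z≤n)))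

  -- A weak form of P n l ≤ 2⁻ˡ, which is all the Archimedean argument for P n l → 0 needs.
  prodRecip*[1+l]≤1 : ∀ n l → P n l * fromℕ (suc l) ≤ 1ℚ
  prodRecip*[1+l]≤1 n zero = ℚₚ.≤-refl
  prodRecip*[1+l]≤1 n (suc l) = begin
    P n l * recip (n +ₙ l) * fromℕ (suc (suc l))
      ≡⟨ ℚₚ.*-assoc (P n l) _ _ ⟩
    P n l * (recip (n +ₙ l) * fromℕ (suc (suc l)))
      ≤⟨ *-monoˡ-≤-0≤ (0≤prodRecip n l) (recip*[2+l]≤1+l (n +ₙ l) l) ⟩
    P n l * fromℕ (suc l)
      ≤⟨ prodRecip*[1+l]≤1 n l ⟩
    1ℚ
      ∎
    where open ℚₚ.≤-Reasoning

  prodRecip<1 : ∀ n l → 1 ≤ₙ l → P n l < 1ℚ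
  prodRecip<1 n l 1≤l = begin-strict
    P n l                  ≡⟨ sym (ℚₚ.+-identityʳ (P n l)) ⟩
    P n l + 0ℚ             <⟨ ℚₚ.+-monoʳ-< (P n l) (0<prodRecip n l) ⟩
    P n l + P n l          ≡⟨ double (P n l) ⟩
    P n l * fromℕ 2        ≤⟨ *-monoˡ-≤-0≤ (0≤prodRecip n l) (fromℕ-mono-≤ (s≤s 1≤l)) ⟩
    P n l * fromℕ (suc l)  ≤⟨ prodRecip*[1+l]≤1 n l ⟩
    1ℚ                     ∎
    where
    open ℚₚ.≤-Reasoning
    double : ∀ x → x + x ≡ x * fromℕ 2
    double = solve-∀ ℚ-ring

  prodRecip→0 : ∀ n → P n ⟶ 0ℚ
  prodRecip→0 n = limit λ δ 0<δ →
    let K , 1≤δK = archimedean δ 0<δ in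
    K , λ M K≤M → begin
    ∣ P n M - 0ℚ ∣                  ≡⟨ trans (cong ∣_∣ (ℚₚ.+-identityʳ (P n M)))
                                             (ℚₚ.0≤p⇒∣p∣≡p (0≤prodRecip n M)) ⟩
    P n M                           ≡⟨ sym (ℚₚ.*-identityʳ (P n M)) ⟩
    P n M * 1ℚ                      ≤⟨ *-monoˡ-≤-0≤ (0≤prodRecip n M) 1≤δK ⟩
    P n M * (δ * fromℕ K)           ≤⟨ *-monoˡ-≤-0≤ (0≤prodRecip n M)
                                         (*-monoˡ-≤-0≤ (ℚₚ.<⇒≤ 0<δ) (fromℕ-mono-≤ (ℕₚ.m≤n⇒m≤1+n K≤M))) ⟩
    P n M * (δ * fromℕ (suc M))     ≡⟨ swap (P n M) δ (fromℕ (suc M)) ⟩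
    δ * (P n M * fromℕ (suc M))     ≤⟨ *-monoˡ-≤-0≤ (ℚₚ.<⇒≤ 0<δ) (prodRecip*[1+l]≤1 n M) ⟩
    δ * 1ℚ                          ≡⟨ ℚₚ.*-identityʳ δ ⟩
    δ                               ∎
    where
    open ℚₚ.≤-Reasoning
    swap : ∀ p δ x → p * (δ * x) ≡ δ * (p * x)
    swap = solve-∀ ℚ-ring

  ∣aSign∣≡1 : ∀ k → ∣ aSign inB k ∣ ≡ 1ℚ
  ∣aSign∣≡1 k with inB k
  ... | true = refl
  ... | false = refl

  ∣term∣≡digit : ∀ k → ∣ term k ∣ ≡ fromℕ (ε k)
  ∣term∣≡digit k = begin
    ∣ aSign inB k * fromℕ (ε k) ∣       ≡⟨ ℚₚ.∣p*q∣≡∣p∣*∣q∣ (aSign inB k) (fromℕ (ε k)) ⟩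
    ∣ aSign inB k ∣ * ∣ fromℕ (ε k) ∣   ≡⟨ cong₂ _*_ (∣aSign∣≡1 k) (∣fromℤ∣≡fromℕ∣∣ (ℤ.+ ε k)) ⟩
    1ℚ * fromℕ (ε k)                    ≡⟨ ℚₚ.*-identityˡ (fromℕ (ε k)) ⟩
    fromℕ (ε k)                         ∎
    where open ≡-Reasoning

  ⟶-sigmaPartial-tail : ∀ j k {s} → S (j +ₙ k) ⟶ s → S j ⟶ (S j k + P j k * s)
  ⟶-sigmaPartial-tail j k tail→s =
    ⟶-unshift k (⟶-cong (λ N → sym (sigmaPartial-+ j k N))
                   (⟶-+ (⟶-const (S j k)) (⟶-*ˡ (P j k) tail→s)))

  qProd : ℕ → ℕ
  qProd zero = 1
  qProd (suc k) = qProd k ℕ.* q (suc k)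

  prodRecip*qProd≡1 : ∀ k → P 0 k * fromℕ (qProd k) ≡ 1ℚ
  prodRecip*qProd≡1 zero = refl
  prodRecip*qProd≡1 (suc k) = begin
    P 0 k * r * fromℕ (qProd k ℕ.* q (suc k))
      ≡⟨ cong (P 0 k * r *_) (fromℕ-homo-* (qProd k) (q (suc k))) ⟩
    P 0 k * r * (fromℕ (qProd k) * fromℕ (q (suc k)))
      ≡⟨ interchange (P 0 k) r (fromℕ (qProd k)) (fromℕ (q (suc k))) ⟩
    (P 0 k * fromℕ (qProd k)) * (r * fromℕ (q (suc k)))
      ≡⟨ cong₂ _*_ (prodRecip*qProd≡1 k) (recip*q≡1 k) ⟩
    1ℚ
      ∎
    where
    open ≡-Reasoning
    r = recip k
    interchange : ∀ a b c d → a * b * (c * d) ≡ (a * c) * (b * d)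
    interchange = solve-∀ ℚ-ring

  sign : ℕ → ℤ
  sign k = if inB k then ℤ.- ℤ.+ 1 else ℤ.+ 1

  fromℤ-sign : ∀ k → fromℤ (sign k) ≡ aSign inB k
  fromℤ-sign k with inB k
  ... | true = refl
  ... | false = refl

  scaledSum : ℕ → ℤ
  scaledSum zero = ℤ.+ 0
  scaledSum (suc k) = scaledSum k ℤ.* ℤ.+ q (suc k) ℤ.+ sign (suc k) ℤ.* ℤ.+ ε (suc k)

  sigmaPartial*qProd≡scaledSum : ∀ k → S 0 k * fromℕ (qProd k) ≡ fromℤ (scaledSum k)
  sigmaPartial*qProd≡scaledSum zero = refl
  sigmaPartial*qProd≡scaledSum (suc k) = begin
    (S 0 k + t * (P 0 k * r)) * fromℕ (qProd k ℕ.* q (suc k))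
      ≡⟨ cong ((S 0 k + t * (P 0 k * r)) *_) (fromℕ-homo-* (qProd k) (q (suc k))) ⟩
    (S 0 k + t * (P 0 k * r)) * (W * Q)
      ≡⟨ distribute (S 0 k) t (P 0 k) r W Q ⟩
    (S 0 k * W) * Q + t * ((P 0 k * W) * (r * Q))
      ≡⟨ cong₂ (λ a b → a * Q + t * b) (sigmaPartial*qProd≡scaledSum k)
               (trans (cong₂ _*_ (prodRecip*qProd≡1 k) (recip*q≡1 k)) (ℚₚ.*-identityˡ 1ℚ)) ⟩
    fromℤ (scaledSum k) * Q + t * 1ℚ
      ≡⟨ cong₂ _+_ (sym (fromℤ-homo-* (scaledSum k) (ℤ.+ q (suc k))))
               (trans (ℚₚ.*-identityʳ t) (trans (cong (_* fromℕ (ε (suc k))) (sym (fromℤ-sign (suc k))))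
                                                (sym (fromℤ-homo-* (sign (suc k)) (ℤ.+ ε (suc k)))))) ⟩
    fromℤ (scaledSum k ℤ.* ℤ.+ q (suc k)) + fromℤ (sign (suc k) ℤ.* ℤ.+ ε (suc k))
      ≡⟨ sym (fromℤ-homo-+ (scaledSum k ℤ.* ℤ.+ q (suc k)) (sign (suc k) ℤ.* ℤ.+ ε (suc k))) ⟩
    fromℤ (scaledSum (suc k))
      ∎
    where
    open ≡-Reasoning
    t = term (suc k)
    r = recip k
    W = fromℕ (qProd k)
    Q = fromℕ (q (suc k))
    distribute : ∀ a t p r w v → (a + t * (p * r)) * (w * v) ≡ (a * w) * v + t * ((p * w) * (r * v))
    distribute = solve-∀ ℚ-ring

  -- σᵏ(x) expressed through x: the splitting at k, multiplied by q₁⋯q_k = 1 / P 0 k.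
  remainder : ℚ → ℕ → ℚ
  remainder x k = fromℕ (qProd k) * (x - S 0 k)

  ⟶-remainder : ∀ {x} → S 0 ⟶ x → ∀ k → S k ⟶ remainder x k
  ⟶-remainder {x} S0→x k =
    ⟶-cong rescale (⟶-*ˡ (fromℕ (qProd k)) (⟶-− (⟶-shift k S0→x) (⟶-const (S 0 k))))
    where
    rescale : ∀ N → fromℕ (qProd k) * (S 0 (k +ₙ N) - S 0 k) ≡ S k N
    rescale N = begin
      W * (S 0 (k +ₙ N) - S 0 k)             ≡⟨ cong (λ z → W * (z - S 0 k)) (sigmaPartial-+ 0 k N) ⟩
      W * (S 0 k + P 0 k * S k N - S 0 k)    ≡⟨ cancel W (S 0 k) (P 0 k) (S k N) ⟩
      (P 0 k * W) * S k N                    ≡⟨ trans (cong (_* S k N) (prodRecip*qProd≡1 k))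
                                                      (ℚₚ.*-identityˡ (S k N)) ⟩
      S k N                                  ∎
      where
      open ≡-Reasoning
      W = fromℕ (qProd k)
      cancel : ∀ w a p s → w * (a + p * s - a) ≡ (p * w) * s
      cancel = solve-∀ ℚ-ring

  remainderNumerator : ℚ → ℕ → ℤ
  remainderNumerator x k = ↥ x ℤ.* ℤ.+ qProd k ℤ.- scaledSum k ℤ.* ℤ.+ ↧ₙ x

  remainder*↧≡remainderNumerator : ∀ x k → remainder x k * fromℕ (↧ₙ x) ≡ fromℤ (remainderNumerator x k)
  remainder*↧≡remainderNumerator x k = sym (begin
    fromℤ (↥ x ℤ.* ℤ.+ qProd k ℤ.- scaledSum k ℤ.* ℤ.+ ↧ₙ x)
      ≡⟨ fromℤ-homo-+ (↥ x ℤ.* ℤ.+ qProd k) (ℤ.- (scaledSum k ℤ.* ℤ.+ ↧ₙ x)) ⟩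
    fromℤ (↥ x ℤ.* ℤ.+ qProd k) + fromℤ (ℤ.- (scaledSum k ℤ.* ℤ.+ ↧ₙ x))
      ≡⟨ cong₂ _+_ (fromℤ-homo-* (↥ x) (ℤ.+ qProd k))
                   (trans (fromℤ-homo-neg (scaledSum k ℤ.* ℤ.+ ↧ₙ x))
                          (cong -_ (fromℤ-homo-* (scaledSum k) (ℤ.+ ↧ₙ x)))) ⟩
    fromℤ (↥ x) * W - fromℤ (scaledSum k) * d
      ≡⟨ cong₂ (λ a b → a * W - b * d) (sym (p*↧p≡↥p x)) (sym (sigmaPartial*qProd≡scaledSum k)) ⟩
    x * d * W - S 0 k * W * d
      ≡⟨ factor x d W (S 0 k) ⟩
    W * (x - S 0 k) * d
      ∎)
    where
    open ≡-Reasoning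
    W = fromℕ (qProd k)
    d = fromℕ (↧ₙ x)
    factor : ∀ x d w s → x * d * w - s * w * d ≡ w * (x - s) * d
    factor = solve-∀ ℚ-ring

  equal-remainders⇒SigmaEq : ∀ {x} → S 0 ⟶ x → ∀ i j → remainder x i ≡ remainder x j →
                             SigmaEq inB q hq ε i j
  equal-remainders⇒SigmaEq {x} S0→x i j same = converges
    (subst ((λ N → S i N - S j N) ⟶_) (ℚₚ.+-inverseʳ (remainder x i))
      (⟶-− (⟶-remainder S0→x i) (subst (S j ⟶_) (sym same) (⟶-remainder S0→x j))))

  module _ (digit<q : ∀ k → 1 ℕ.≤ k → ε k ℕ.< q k) where

    digit+1≤q : ∀ n → fromℕ (ε (suc n)) + 1ℚ ≤ fromℕ (q (suc n))
    digit+1≤q n = subst (_≤ fromℕ (q (suc n))) (fromℤ-homo-+ (ℤ.+ ε (suc n)) (ℤ.+ 1))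
      (fromℕ-mono-≤ (subst (_≤ₙ q (suc n)) (ℕₚ.+-comm 1 (ε (suc n))) (digit<q (suc n) (s≤s z≤n))))

    ∣sigmaPartial∣≤1 : ∀ n N → ∣ S n N ∣ ≤ 1ℚ
    ∣sigmaPartial∣≤1 n zero = ℚₚ.nonNegative⁻¹ 1ℚ
    ∣sigmaPartial∣≤1 n (suc N) = begin
      ∣ S n (suc N) ∣                            ≡⟨ cong ∣_∣ (sigmaPartial-+ n 1 N) ⟩
      ∣ S n 1 + P n 1 * S (n +ₙ 1) N ∣           ≤⟨ ℚₚ.∣p+q∣≤∣p∣+∣q∣ (S n 1) _ ⟩
      ∣ S n 1 ∣ + ∣ P n 1 * S (n +ₙ 1) N ∣       ≡⟨ cong₂ _+_ ∣first-term∣ ∣rest∣ ⟩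
      d * r + r * ∣ S (n +ₙ 1) N ∣               ≤⟨ ℚₚ.+-monoʳ-≤ (d * r)
                                                      (*-monoˡ-≤-0≤ 0≤r (∣sigmaPartial∣≤1 (n +ₙ 1) N)) ⟩
      d * r + r * 1ℚ                             ≡⟨ collect d r ⟩
      (d + 1ℚ) * r                               ≤⟨ *-monoʳ-≤-0≤ 0≤r (digit+1≤q n) ⟩
      fromℕ (q (suc n)) * r                      ≡⟨ trans (ℚₚ.*-comm _ r) (recip*q≡1 n) ⟩
      1ℚ                                         ∎
      where
      open ℚₚ.≤-Reasoning
      d = fromℕ (ε (suc n))
      r = recip n
      0≤r : 0ℚ ≤ r
      0≤r = ℚₚ.<⇒≤ (0<recip n)
      ∣first-term∣ : ∣ S n 1 ∣ ≡ d * r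
      ∣first-term∣ = trans (cong ∣_∣ (sigmaPartial-1 n))
        (trans (ℚₚ.∣p*q∣≡∣p∣*∣q∣ (term (suc n)) r)
               (cong₂ _*_ (∣term∣≡digit (suc n)) (ℚₚ.0≤p⇒∣p∣≡p 0≤r)))
      ∣rest∣ : ∣ P n 1 * S (n +ₙ 1) N ∣ ≡ r * ∣ S (n +ₙ 1) N ∣
      ∣rest∣ = trans (∣r*p∣≡r*∣p∣ (S (n +ₙ 1) N) (0≤prodRecip n 1))
                     (cong (_* ∣ S (n +ₙ 1) N ∣) (prodRecip-1 n))
      collect : ∀ d r → d * r + r * 1ℚ ≡ (d + 1ℚ) * r
      collect = solve-∀ ℚ-ring

    -- Comparing the two splittings S n (N + m) and S n (m + N) of the same partial sum.
    [1-P]*sigmaPartial≡ : ∀ n m N → (1ℚ - P n m) * S n N ≡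
               S n m - P n m * (S n N - S (n +ₙ m) N) - P n N * S (n +ₙ N) m
    [1-P]*sigmaPartial≡ n m N = begin
      (1ℚ - c) * A                                  ≡⟨ expand A c X t ⟩
      (A + t) - c * (A - X) - t - c * X             ≡⟨ cong (λ z → z - c * (A - X) - t - c * X) splittings ⟩
      (S n m + c * X) - c * (A - X) - t - c * X     ≡⟨ cancel (S n m) c A X t ⟩
      S n m - c * (A - X) - t                       ∎
      where
      open ≡-Reasoning
      c = P n m
      A = S n N
      X = S (n +ₙ m) N
      t = P n N * S (n +ₙ N) m
      splittings : A + t ≡ S n m + c * X
      splittings = trans (sym (sigmaPartial-+ n N m))
                         (trans (cong (S n) (ℕₚ.+-comm N m)) (sigmaPartial-+ n m N))
      expand : ∀ A c X t → (1ℚ - c) * A ≡ (A + t) - c * (A - X) - t - c * X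
      expand = solve-∀ ℚ-ring
      cancel : ∀ T c A X t → (T + c * X) - c * (A - X) - t - c * X ≡ T - c * (A - X) - t
      cancel = solve-∀ ℚ-ring

    ∣prodRecip*sigmaPartial∣≤prodRecip : ∀ n l N → ∣ P n l * S (n +ₙ l) N ∣ ≤ P n l
    ∣prodRecip*sigmaPartial∣≤prodRecip n l N = begin
      ∣ P n l * S (n +ₙ l) N ∣     ≡⟨ ∣r*p∣≡r*∣p∣ (S (n +ₙ l) N) (0≤prodRecip n l) ⟩
      P n l * ∣ S (n +ₙ l) N ∣     ≤⟨ *-monoˡ-≤-0≤ (0≤prodRecip n l) (∣sigmaPartial∣≤1 (n +ₙ l) N) ⟩
      P n l * 1ℚ                   ≡⟨ ℚₚ.*-identityʳ (P n l) ⟩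
      P n l                        ∎
      where open ℚₚ.≤-Reasoning

    SigmaEq⇒[1-P]*sigmaPartial⟶ : ∀ n m → SigmaEq inB q hq ε n (n +ₙ m) →
                                  (λ N → (1ℚ - P n m) * S n N) ⟶ S n m
    SigmaEq⇒[1-P]*sigmaPartial⟶ n m σⁿ≡σⁿ⁺ᵐ =
      subst ((λ N → (1ℚ - c) * S n N) ⟶_) (vanish (S n m) c)
        (⟶-cong (λ N → sym ([1-P]*sigmaPartial≡ n m N))
          (⟶-− (⟶-− (⟶-const (S n m)) (⟶-*ˡ c (limit σⁿ≡σⁿ⁺ᵐ)))
               (⟶-squeeze (λ N → ∣prodRecip*sigmaPartial∣≤prodRecip n N m) (prodRecip→0 n))))
      where
      c = P n m
      vanish : ∀ T c → T - c * 0ℚ - 0ℚ ≡ T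
      vanish = solve-∀ ℚ-ring

    SigmaEq⇒IsRationalSum : ∀ n m → 1 ≤ₙ m → SigmaEq inB q hq ε n (n +ₙ m) → IsRationalSum inB q hq ε
    SigmaEq⇒IsRationalSum n m 1≤m σⁿ≡σⁿ⁺ᵐ = S 0 n + P 0 n * σⁿ ,
      converges (⟶-sigmaPartial-tail 0 n
        (⟶-cong (λ N → cancel (S n N)) (⟶-*ˡ (1/ (1ℚ - c)) (SigmaEq⇒[1-P]*sigmaPartial⟶ n m σⁿ≡σⁿ⁺ᵐ))))
      where
      c = P n m
      instance
        1-c-nonZero : ℚ.NonZero (1ℚ - c)
        1-c-nonZero = ℚₚ.pos⇒nonZero (1ℚ - c) {{ℚ.positive (p<q⇒0<q-p (prodRecip<1 n m 1≤m))}}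
      σⁿ : ℚ
      σⁿ = 1/ (1ℚ - c) * S n m
      cancel : ∀ x → 1/ (1ℚ - c) * ((1ℚ - c) * x) ≡ x
      cancel x = trans (sym (ℚₚ.*-assoc (1/ (1ℚ - c)) (1ℚ - c) x))
                       (trans (cong (_* x) (ℚₚ.*-inverseˡ (1ℚ - c))) (ℚₚ.*-identityˡ x))

    ∣remainderNumerator∣≤↧ : ∀ {x} → S 0 ⟶ x → ∀ k → ℤ.∣ remainderNumerator x k ∣ ≤ₙ ↧ₙ x
    ∣remainderNumerator∣≤↧ {x} S0→x k = ℤₚ.drop‿+≤+ (fromℤ-cancel-≤ (begin
      fromℕ ℤ.∣ z ∣              ≡⟨ sym (∣fromℤ∣≡fromℕ∣∣ z) ⟩
      ∣ fromℤ z ∣                ≡⟨ cong ∣_∣ (sym (remainder*↧≡remainderNumerator x k)) ⟩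
      ∣ remainder x k * d ∣      ≡⟨ trans (ℚₚ.∣p*q∣≡∣p∣*∣q∣ (remainder x k) d)
                                          (cong (∣ remainder x k ∣ *_) (ℚₚ.0≤p⇒∣p∣≡p (0≤fromℕ (↧ₙ x)))) ⟩
      ∣ remainder x k ∣ * d      ≤⟨ *-monoʳ-≤-0≤ (0≤fromℕ (↧ₙ x))
                                      (⟶-bounded (∣sigmaPartial∣≤1 k) (⟶-remainder S0→x k)) ⟩
      1ℚ * d                     ≡⟨ ℚₚ.*-identityˡ d ⟩
      d                          ∎))
      where
      open ℚₚ.≤-Reasoning
      z = remainderNumerator x k
      d = fromℕ (↧ₙ x)

    collision⇒SigmaEq : ∀ {x} → S 0 ⟶ x → ∀ i j → i <ₙ j →
                        remainderNumerator x i ≡ remainderNumerator x j →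
                        SigmaEq inB q hq ε i (i +ₙ (j ∸ i))
    collision⇒SigmaEq {x} S0→x i j i<j same-numerator =
      subst (SigmaEq inB q hq ε i) (sym (ℕₚ.m+[n∸m]≡n (ℕₚ.<⇒≤ i<j)))
        (equal-remainders⇒SigmaEq S0→x i j same-remainder)
      where
      same-remainder : remainder x i ≡ remainder x j
      same-remainder = *-cancelʳ-≡-pos (0<fromℕ-↧ x)
        (trans (remainder*↧≡remainderNumerator x i)
          (trans (cong fromℤ same-numerator) (sym (remainder*↧≡remainderNumerator x j))))

    IsRationalSum⇒SigmaEq : IsRationalSum inB q hq ε →
                            ∃₂ λ n m → 1 ≤ₙ m × SigmaEq inB q hq ε n (n +ₙ m)
    IsRationalSum⇒SigmaEq (x , S0→x) =
      let i , j , i<j , same-numerator = bounded-pigeonhole (↧ₙ x) (remainderNumerator x)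
                                           (∣remainderNumerator∣≤↧ (limit S0→x))
      in i , j ∸ i , ℕₚ.m<n⇒0<n∸m i<j , collision⇒SigmaEq (limit S0→x) i j i<j same-numerator

open import Data.Nat using (_+_; _≤_; _<_)
open import Data.Product using (∃₂; _×_; _,_)
open import Function.Bundles using (_⇔_; mk⇔)

mainTheorem2 : (inB : ℕ → Bool) (q : ℕ → ℕ) (hq : ∀ k → 1 ≤ k → 2 ≤ q k)
    (ε : ℕ → ℕ) → (∀ k → 1 ≤ k → ε k < q k) →
    IsRationalSum inB q hq ε ⇔ (∃₂ λ (n m : ℕ) → 1 ≤ m × SigmaEq inB q hq ε n (n + m))
mainTheorem2 inB q hq ε digit<q = mk⇔
  (IsRationalSum⇒SigmaEq digit<q)
  (λ (n , m , 1≤m , σⁿ≡σⁿ⁺ᵐ) → SigmaEq⇒IsRationalSum digit<q n m 1≤m σⁿ≡σⁿ⁺ᵐ)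
  where open SignVariableCantorSeries inB q hq ε
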